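{- Let $D$ and $D'$ be digraphs whose intersection $D\cap D'$ is a tournament $T$. Let $f$ be a colouring of $D$ and $f'$ a colouring of $D'$ (with the same set of colours) such that $f$ and $f'$ agree on $V(T)$. Then the common extension of $f$ and $f'$ to $V(D)\cup V(D')$ is a colouring of $D\cup D'$.
   Context: A colouring of a digraph $D$ is a function $f$ from $V(D)$ to a finite set of colours such that for each colour $i$, the subdigraph of $D$ induced by the vertices of colour $i$ contains no directed cycle. A tournament is a digraph in which each pair of distinct vertices is joined by exactly one arc. -}

module Defs where

open import Data.Nat using (ℕ; suc)
open import Data.Fin using (Fin; zero; suc; inject₁; fromℕ)
open import Data.Product using (_×_; Σ; ∃)
open import Data.Sum using (_⊎_)
open import Relation.Nullary using (¬_)
open import Relation.Binary.PropositionalEquality using (_≡_; _≢_)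
open import Function.Definitions using (Injective)

record Digraph (n : ℕ) : Set₁ where
  field
    vertex   : Fin n → Set
    arc      : Fin n → Fin n → Set
    arc-tail : ∀ {u v} → arc u v → vertex u
    arc-head : ∀ {u v} → arc u v → vertex v
    loopless : ∀ {v} → ¬ arc v v
open Digraph public

_∩ᴰ_ : ∀ {n} → Digraph n → Digraph n → Digraph n
D ∩ᴰ D' = record
  { vertex   = λ v → vertex D v × vertex D' v
  ; arc      = λ u v → arc D u v × arc D' u v
  ; arc-tail = λ (a , a') → arc-tail D a , arc-tail D' a'
  ; arc-head = λ (a , a') → arc-head D a , arc-head D' a'
  ; loopless = λ (a , _) → loopless D a
  }
  where open Data.Product using (_,_)

_∪ᴰ_ : ∀ {n} → Digraph n → Digraph n → Digraph n
D ∪ᴰ D' = record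
  { vertex   = λ v → vertex D v ⊎ vertex D' v
  ; arc      = λ u v → arc D u v ⊎ arc D' u v
  ; arc-tail = [ (λ a → inj₁ (arc-tail D a)) , (λ a → inj₂ (arc-tail D' a)) ]
  ; arc-head = [ (λ a → inj₁ (arc-head D a)) , (λ a → inj₂ (arc-head D' a)) ]
  ; loopless = [ loopless D , loopless D' ]
  }
  where open Data.Sum using (inj₁; inj₂; [_,_])

IsTournament : ∀ {n} → Digraph n → Set
IsTournament T = ∀ {u v} → vertex T u → vertex T v → u ≢ v →
  (arc T u v ⊎ arc T v u) × ¬ (arc T u v × arc T v u)

induced : ∀ {n} → Digraph n → (Fin n → Set) → Digraph n
induced D P = record
  { vertex   = λ v → vertex D v × P v
  ; arc      = λ u v → arc D u v × (P u × P v)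
  ; arc-tail = λ (a , pu , _) → arc-tail D a , pu
  ; arc-head = λ (a , _ , pv) → arc-head D a , pv
  ; loopless = λ (a , _) → loopless D a
  }
  where open Data.Product using (_,_)

-- A directed cycle: distinct vertices c 0, …, c m with arcs
-- c i → c (i+1) and c m → c 0 (length ≥ 2 forced by looplessness).
DirectedCycle : ∀ {n} → Digraph n → Set
DirectedCycle {n} D =
  Σ ℕ λ m → Σ (Fin (suc m) → Fin n) λ c →
    Injective _≡_ _≡_ c ×
    (∀ (i : Fin m) → arc D (c (inject₁ i)) (c (suc i))) ×
    arc D (c (fromℕ m)) (c zero)

-- f : Fin n → Fin k is a colouring of D (with colour set Fin k):
-- each colour class induces an acyclic subdigraph.  Only the values of
-- f on the vertices of D are relevant.
IsColouring : ∀ {n k} → Digraph n → (Fin n → Fin k) → Set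
IsColouring D f = ∀ i → ¬ DirectedCycle (induced D (λ v → f v ≡ i))

-- A colour class is an acyclic digraph, so it suffices that the union of two
-- acyclic digraphs G and G' whose intersection is a tournament is acyclic.
-- Follow a closed walk of G ∪ G' from a vertex of G.  Each maximal stretch of
-- it inside G' joins two vertices of the tournament, distinct because G' is
-- acyclic; the tournament arc between them points forward, since otherwise it
-- would close a cycle in G', and it is an arc of G.  Replacing every such
-- stretch by its tournament arc leaves a closed walk in G.
module Submission where

open import Defs
open import Data.Nat using (ℕ; zero; suc)
open import Data.Fin using (Fin; zero; suc; inject₁; fromℕ; _≟_)
open import Relation.Binary.PropositionalEquality using (_≡_; refl; sym; trans; cong)

open import Level using (Level; _⊔_)
open import Data.List using (List; []; _∷_; length; lookup)
open import Data.List.Membership.Propositional using (_∈_)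
open import Data.List.Membership.Propositional.Properties using (∈-lookup)
open import Data.List.Relation.Unary.Any using (here; there)
open import Data.List.Relation.Unary.All using ([])
import Data.List.Relation.Unary.All as All
open import Data.List.Relation.Unary.All.Properties using (¬Any⇒All¬)
open import Data.List.Relation.Unary.Unique.Propositional using (Unique; []; _∷_)
open import Data.Product using (Σ; ∃; _×_; _,_; proj₁; proj₂)
import Data.Product as Prod
open import Data.Sum using (inj₁; inj₂)
import Data.Sum as Sum
open import Data.Empty using (⊥-elim)
open import Function using (_∘_; Injective)
open import Relation.Nullary using (¬_; yes; no)
open import Relation.Binary.Core using (Rel; _⇒_)
open import Relation.Binary.Definitions using (DecidableEquality)
open import Relation.Binary.Construct.Closure.Transitive using (TransClosure; [_]; _∷_; _∷ʳ_)

private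
  variable
    a ℓ : Level
    A : Set a
    n : ℕ

map⁺ : {R S : Rel A ℓ} → R ⇒ S → TransClosure R ⇒ TransClosure S
map⁺ R⇒S [ r ] = [ R⇒S r ]
map⁺ R⇒S (r ∷ p) = R⇒S r ∷ map⁺ R⇒S p

-- DirectedCycle D is Cycle (arc D) by definition.
Cycle : Rel A ℓ → Set _
Cycle {A = A} R = Σ ℕ λ m → Σ (Fin (suc m) → A) λ c →
  Injective _≡_ _≡_ c ×
  (∀ (i : Fin m) → R (c (inject₁ i)) (c (suc i))) ×
  R (c (fromℕ m)) (c zero)

-- Walk R vs y: a walk ending in y whose list of earlier vertices is vs.
data Walk {A : Set a} (R : Rel A ℓ) : List A → A → Set (a ⊔ ℓ) where
  [_] : ∀ {x y} → R x y → Walk R (x ∷ []) y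
  _∷_ : ∀ {x w vs y} → R x w → Walk R (w ∷ vs) y → Walk R (x ∷ w ∷ vs) y

SimpleWalk : Rel A ℓ → A → A → Set _
SimpleWalk {A = A} R x y = Σ (List A) λ vs → Walk R (x ∷ vs) y × Unique (x ∷ vs)

Unique⇒lookup-injective : ∀ {xs : List A} → Unique xs → Injective _≡_ _≡_ (lookup xs)
Unique⇒lookup-injective (_ ∷ _) {zero} {zero} _ = refl
Unique⇒lookup-injective (x≢ ∷ _) {zero} {suc j} eq = ⊥-elim (All.lookup x≢ (∈-lookup j) eq)
Unique⇒lookup-injective (x≢ ∷ _) {suc i} {zero} eq = ⊥-elim (All.lookup x≢ (∈-lookup i) (sym eq))
Unique⇒lookup-injective (_ ∷ u) {suc i} {suc j} eq = cong suc (Unique⇒lookup-injective u eq)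

module _ {R : Rel A ℓ} where

  walk-step : ∀ {x vs y} → Walk R (x ∷ vs) y →
    ∀ (i : Fin (length vs)) → R (lookup (x ∷ vs) (inject₁ i)) (lookup (x ∷ vs) (suc i))
  walk-step (r ∷ _) zero = r
  walk-step (_ ∷ p) (suc i) = walk-step p i

  walk-last : ∀ {x vs y} → Walk R (x ∷ vs) y → R (lookup (x ∷ vs) (fromℕ (length vs))) y
  walk-last [ r ] = r
  walk-last (_ ∷ p) = walk-last p

  simpleClosedWalk⇒cycle : ∀ {x} → SimpleWalk R x x → Cycle R
  simpleClosedWalk⇒cycle {x} (vs , p , u) =
    length vs , lookup (x ∷ vs) , Unique⇒lookup-injective u , walk-step p , walk-last p

  dropUntil : ∀ {x vs y} → x ∈ vs → Walk R vs y → Unique vs → SimpleWalk R x y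
  dropUntil (here refl) p u = _ , p , u
  dropUntil (there x∈) (_ ∷ p) (_ ∷ u) = dropUntil x∈ p u

  module _ (_≟ᴬ_ : DecidableEquality A) where
    open import Data.List.Membership.DecPropositional _≟ᴬ_ using (_∈?_)

    toSimpleWalk : ∀ {x y} → TransClosure R x y → SimpleWalk R x y
    toSimpleWalk [ r ] = [] , [ r ] , [] ∷ []
    toSimpleWalk {x} (r ∷ p) with toSimpleWalk p
    ... | vs , q , u with x ∈? (_ ∷ vs)
    ...   | yes x∈ = dropUntil x∈ q u
    ...   | no x∉ = _ , r ∷ q , ¬Any⇒All¬ _ x∉ ∷ u

    closedWalk⇒cycle : ∀ {x} → TransClosure R x x → Cycle R
    closedWalk⇒cycle = simpleClosedWalk⇒cycle ∘ toSimpleWalk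

  cycle⇒closedWalk : Cycle R → ∃ λ x → TransClosure R x x
  cycle⇒closedWalk (m , c , _ , steps , last) = c zero , walkAlong m c steps last
    where
    walkAlong : ∀ {y} m (c : Fin (suc m) → A) → (∀ i → R (c (inject₁ i)) (c (suc i))) →
      R (c (fromℕ m)) y → TransClosure R (c zero) y
    walkAlong zero c _ last = [ last ]
    walkAlong (suc m) c steps last = steps zero ∷ walkAlong m (c ∘ suc) (steps ∘ suc) last

Acyclic : Digraph n → Set
Acyclic G = ∀ {v} → ¬ TransClosure (arc G) v v

module _ (G : Digraph n) where

  ¬directedCycle⇒acyclic : ¬ DirectedCycle G → Acyclic G
  ¬directedCycle⇒acyclic ¬cycle p = ¬cycle (closedWalk⇒cycle _≟_ p)

  acyclic⇒¬directedCycle : Acyclic G → ¬ DirectedCycle G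
  acyclic⇒¬directedCycle acyclic cycle = acyclic (proj₂ (cycle⇒closedWalk {R = arc G} cycle))

  ⁺-tail : ∀ {v w} → TransClosure (arc G) v w → vertex G v
  ⁺-tail [ e ] = arc-tail G e
  ⁺-tail (e ∷ _) = arc-tail G e

  ⁺-head : ∀ {v w} → TransClosure (arc G) v w → vertex G w
  ⁺-head [ e ] = arc-head G e
  ⁺-head (_ ∷ p) = ⁺-head p

acyclic-⊆ : (G H : Digraph n) → arc G ⇒ arc H → Acyclic H → Acyclic G
acyclic-⊆ G H G⊆H acyclic = acyclic ∘ map⁺ G⊆H

∩ᴰ-tournament-comm : (G G' : Digraph n) → IsTournament (G ∩ᴰ G') → IsTournament (G' ∩ᴰ G)
∩ᴰ-tournament-comm G G' tournament (u' , u) (v' , v) u≢v =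
  Sum.map Prod.swap Prod.swap joined , notBoth ∘ Prod.map Prod.swap Prod.swap
  where
  joined = proj₁ (tournament (u , u') (v , v') u≢v)
  notBoth = proj₂ (tournament (u , u') (v , v') u≢v)

module _ (G G' : Digraph n) (tournament : IsTournament (G ∩ᴰ G')) (acyclic' : Acyclic G') where

  bridge : ∀ {v w} → vertex G v → vertex G w → TransClosure (arc G') v w → arc G v w
  bridge {v} {w} v∈G w∈G p with v ≟ w
  ... | yes refl = ⊥-elim (acyclic' p)
  ... | no v≢w with proj₁ (tournament (v∈G , ⁺-tail G' p) (w∈G , ⁺-head G' p) v≢w)
  ...   | inj₁ (e , _) = e
  ...   | inj₂ (_ , e') = ⊥-elim (acyclic' (p ∷ʳ e'))

  mutual
    collapse : ∀ {v w} → vertex G v → vertex G w →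
      TransClosure (arc (G ∪ᴰ G')) v w → TransClosure (arc G) v w
    collapse v∈G w∈G [ inj₁ e ] = [ e ]
    collapse v∈G w∈G [ inj₂ e' ] = [ bridge v∈G w∈G [ e' ] ]
    collapse v∈G w∈G (inj₁ e ∷ p) = e ∷ collapse (arc-head G e) w∈G p
    collapse v∈G w∈G (inj₂ e' ∷ p) = collapseAfter v∈G w∈G [ e' ] p

    collapseAfter : ∀ {v u w} → vertex G v → vertex G w → TransClosure (arc G') v u →
      TransClosure (arc (G ∪ᴰ G')) u w → TransClosure (arc G) v w
    collapseAfter v∈G w∈G s [ inj₁ e ] = bridge v∈G (arc-tail G e) s ∷ [ e ]
    collapseAfter v∈G w∈G s [ inj₂ e' ] = [ bridge v∈G w∈G (s ∷ʳ e') ]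
    collapseAfter v∈G w∈G s (inj₁ e ∷ p) =
      bridge v∈G (arc-tail G e) s ∷ e ∷ collapse (arc-head G e) w∈G p
    collapseAfter v∈G w∈G s (inj₂ e' ∷ p) = collapseAfter v∈G w∈G (s ∷ʳ e') p

∪ᴰ-acyclic : (G G' : Digraph n) → IsTournament (G ∩ᴰ G') →
  Acyclic G → Acyclic G' → Acyclic (G ∪ᴰ G')
∪ᴰ-acyclic G G' tournament acyclic acyclic' p with ⁺-tail (G ∪ᴰ G') p
... | inj₁ v∈G = acyclic (collapse G G' tournament acyclic' v∈G v∈G p)
... | inj₂ v∈G' = acyclic' (collapse G' G (∩ᴰ-tournament-comm G G' tournament) acyclic
                              v∈G' v∈G' (map⁺ Sum.swap p))

module _ {P : Fin n → Set} where

  induced-⊆ : ∀ (D : Digraph n) {Q : Fin n → Set} → (∀ {v} → vertex D v → P v → Q v) →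
    arc (induced D P) ⇒ arc (induced D Q)
  induced-⊆ D P⇒Q (e , pu , pv) = e , P⇒Q (arc-tail D e) pu , P⇒Q (arc-head D e) pv

  induced-∪ᴰ : ∀ (D D' : Digraph n) → arc (induced (D ∪ᴰ D') P) ⇒ arc (induced D P ∪ᴰ induced D' P)
  induced-∪ᴰ D D' (inj₁ e , pu , pv) = inj₁ (e , pu , pv)
  induced-∪ᴰ D D' (inj₂ e , pu , pv) = inj₂ (e , pu , pv)

  induced-∩ᴰ-tournament : ∀ (D D' : Digraph n) → IsTournament (D ∩ᴰ D') →
    IsTournament (induced D P ∩ᴰ induced D' P)
  induced-∩ᴰ-tournament D D' tournament ((u∈D , pu) , (u∈D' , _)) ((v∈D , pv) , (v∈D' , _)) u≢v =
    Sum.map (λ (e , e') → (e , pu , pv) , (e' , pu , pv))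
            (λ (e , e') → (e , pv , pu) , (e' , pv , pu)) joined ,
    notBoth ∘ Prod.map (Prod.map proj₁ proj₁) (Prod.map proj₁ proj₁)
    where
    joined = proj₁ (tournament (u∈D , u∈D') (v∈D , v∈D') u≢v)
    notBoth = proj₂ (tournament (u∈D , u∈D') (v∈D , v∈D') u≢v)

colourClass-acyclic : ∀ {k} (D : Digraph n) {f h : Fin n → Fin k} → IsColouring D f →
  (∀ v → vertex D v → h v ≡ f v) → ∀ i → Acyclic (induced D (λ v → h v ≡ i))
colourClass-acyclic D {f} {h} colouring h≗f i =
  acyclic-⊆ (induced D (λ v → h v ≡ i)) (induced D (λ v → f v ≡ i))
    (induced-⊆ D (λ {v} v∈D hv≡i → trans (sym (h≗f v v∈D)) hv≡i))
    (¬directedCycle⇒acyclic (induced D (λ v → f v ≡ i)) (colouring i))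

lemma2p2 : ∀ {n k : ℕ} (D D' : Digraph n) → IsTournament (D ∩ᴰ D') →
    (f f' : Fin n → Fin k) → IsColouring D f → IsColouring D' f' →
    (∀ v → vertex (D ∩ᴰ D') v → f v ≡ f' v) →
    (h : Fin n → Fin k) →
    (∀ v → vertex D v → h v ≡ f v) →
    (∀ v → vertex D' v → h v ≡ f' v) →
    IsColouring (D ∪ᴰ D') h
lemma2p2 D D' tournament f f' f-colouring f'-colouring _ h h≗f h≗f' i =
  acyclic⇒¬directedCycle (induced (D ∪ᴰ D') colour-i)
    (acyclic-⊆ (induced (D ∪ᴰ D') colour-i) (induced D colour-i ∪ᴰ induced D' colour-i)
      (induced-∪ᴰ D D')
      (∪ᴰ-acyclic (induced D colour-i) (induced D' colour-i)
        (induced-∩ᴰ-tournament D D' tournament)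
        (colourClass-acyclic D f-colouring h≗f i)
        (colourClass-acyclic D' f'-colouring h≗f' i)))
  where
  colour-i : Fin _ → Set
  colour-i v = h v ≡ i
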